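{- Let $G$ be a connected $\{P_4, C_4\}$-free graph. Then every MNS ordering of $G$ is also a LexDFS ordering of $G$.
   Context: All graphs are finite and simple. For an ordering $\sigma$ of $V(G)$ write $x<_\sigma y$ if $x$ precedes $y$. In each of the following, the condition is required for all $a<_\sigma b<_\sigma c$ with $ac\in E(G)$ and $ab\notin E(G)$: $\sigma$ is a LexDFS ordering if there is $d$ with $a<_\sigma d<_\sigma b$, $db\in E(G)$, $dc\notin E(G)$; an MNS ordering if there is $d$ with $d<_\sigma b$, $db\in E(G)$, $dc\notin E(G)$. $\{P_4,C_4\}$-free means no induced path on 4 vertices and no induced 4-cycle. -}

module Defs where

open import Data.Nat using (ℕ)
open import Data.Fin using (Fin; _<_)
open import Data.Product using (Σ; ∃; _×_; _,_)
open import Relation.Nullary using (¬_)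
open import Relation.Binary.PropositionalEquality using (_≡_; _≢_)
open import Function.Definitions using (Injective)

record Graph (n : ℕ) : Set₁ where
  field
    E     : Fin n → Fin n → Set
    sym   : ∀ {x y} → E x y → E y x
    irrefl : ∀ {x} → ¬ E x x
open Graph public

data Reach {n : ℕ} (G : Graph n) : Fin n → Fin n → Set where
  here : ∀ {x} → Reach G x x
  step : ∀ {x y z} → E G x y → Reach G y z → Reach G x z

Connected : ∀ {n} → Graph n → Set
Connected G = ∀ x y → Reach G x y

HasInducedP4 : ∀ {n} → Graph n → Set
HasInducedP4 {n} G = Σ (Fin n) λ a → Σ (Fin n) λ b → Σ (Fin n) λ c → Σ (Fin n) λ d →
  (a ≢ b × a ≢ c × a ≢ d × b ≢ c × b ≢ d × c ≢ d) ×
  (E G a b × E G b c × E G c d) ×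
  (¬ E G a c × ¬ E G b d × ¬ E G a d)

HasInducedC4 : ∀ {n} → Graph n → Set
HasInducedC4 {n} G = Σ (Fin n) λ a → Σ (Fin n) λ b → Σ (Fin n) λ c → Σ (Fin n) λ d →
  (a ≢ b × a ≢ c × a ≢ d × b ≢ c × b ≢ d × c ≢ d) ×
  (E G a b × E G b c × E G c d × E G d a) ×
  (¬ E G a c × ¬ E G b d)

P4C4Free : ∀ {n} → Graph n → Set
P4C4Free G = ¬ HasInducedP4 G × ¬ HasInducedC4 G

-- An ordering σ of V(G) = Fin n, given by the position map pos : Fin n → Fin n,
-- which is required to be injective (hence a bijection).
record Ordering (n : ℕ) : Set where
  field
    pos    : Fin n → Fin n
    pos-inj : Injective _≡_ _≡_ pos
open Ordering public

_<[_]_ : ∀ {n} → Fin n → Ordering n → Fin n → Set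
x <[ σ ] y = pos σ x < pos σ y

IsLexDFS : ∀ {n} → Graph n → Ordering n → Set
IsLexDFS {n} G σ = ∀ a b c → a <[ σ ] b → b <[ σ ] c → E G a c → ¬ E G a b →
  ∃ λ d → a <[ σ ] d × d <[ σ ] b × E G d b × ¬ E G d c

IsMNS : ∀ {n} → Graph n → Ordering n → Set
IsMNS {n} G σ = ∀ a b c → a <[ σ ] b → b <[ σ ] c → E G a c → ¬ E G a b →
  ∃ λ d → d <[ σ ] b × E G d b × ¬ E G d c

{-# OPTIONS --safe #-}
module Submission where

-- An MNS ordering of a {P₄, C₄}-free graph has no triple a <σ b <σ c with
-- ac ∈ E, ab ∉ E, so the LexDFS condition holds vacuously. Given such a
-- triple, MNS supplies d <σ b with db ∈ E, dc ∉ E; an edge da would close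
-- b–d–a–c into an induced P₄ or C₄, so da ∉ E. Depending on whether d
-- precedes or follows a, either (d, a, b) or (a, d, c) is again such a
-- triple, with middle vertex a or d strictly before b: induct on the
-- position of the middle vertex.

open import Data.Nat using (ℕ)
open import Data.Fin using (Fin; _<_)
open import Data.Fin.Properties using (<-cmp; <-trans; <-irrefl)
open import Data.Fin.Induction using (<-wellFounded)
open import Data.Product using (_×_; _,_)
open import Data.Empty using (⊥-elim)
open import Induction.WellFounded using (Acc; acc)
open import Relation.Nullary using (¬_)
open import Relation.Binary using (tri<; tri≈; tri>)
open import Relation.Binary.PropositionalEquality using (_≢_; ≢-sym; refl; subst)
open import Defs

module _ {n : ℕ} (G : Graph n) where

  adjacent⇒≢ : ∀ {x y} → E G x y → x ≢ y
  adjacent⇒≢ e refl = Graph.irrefl G e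

  adjacent-nonadjacent⇒≢ : ∀ {x y z} → E G x z → ¬ E G y z → x ≢ y
  adjacent-nonadjacent⇒≢ e ne refl = ne e

  P4C4Free⇒¬bridge : P4C4Free G → ∀ {a b c d} → a ≢ b → b ≢ c → d ≢ c →
    E G a c → E G d b → ¬ E G a b → ¬ E G d c → ¬ E G d a
  P4C4Free⇒¬bridge (noP4 , noC4) {a} {b} {c} {d} a≢b b≢c d≢c ac db ¬ab ¬dc da =
    noP4 (b , d , a , c , distinct , (Graph.sym G db , da , ac) , ¬ba , ¬dc , ¬bc)
    where
    distinct : b ≢ d × b ≢ a × b ≢ c × d ≢ a × d ≢ c × a ≢ c
    distinct = ≢-sym (adjacent⇒≢ db) , ≢-sym a≢b , b≢c ,
               adjacent-nonadjacent⇒≢ db ¬ab , d≢c , adjacent⇒≢ ac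
    ¬ba : ¬ E G b a
    ¬ba ba = ¬ab (Graph.sym G ba)
    ¬bc : ¬ E G b c
    ¬bc bc = noC4 (b , d , a , c , distinct , (Graph.sym G db , da , ac , Graph.sym G bc) , ¬ba , ¬dc)

module _ {n : ℕ} (G : Graph n) (σ : Ordering n) where

  <σ⇒≢ : ∀ {x y} → x <[ σ ] y → x ≢ y
  <σ⇒≢ x<y refl = <-irrefl refl x<y

  Obstruction : Fin n → Fin n → Fin n → Set
  Obstruction a b c = a <[ σ ] b × b <[ σ ] c × E G a c × ¬ E G a b

  MNS⇒no-obstruction : P4C4Free G → IsMNS G σ → ∀ a b c → ¬ Obstruction a b c
  MNS⇒no-obstruction free mns a b c = go (<-wellFounded (pos σ b)) a c
    where
    go : ∀ {b} → Acc _<_ (pos σ b) → ∀ a c → ¬ Obstruction a b c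
    go {b} (acc earlier) a c (a<b , b<c , ac , ¬ab)
      with mns a b c a<b b<c ac ¬ab
    ... | d , d<b , db , ¬dc
      with ¬da ← P4C4Free⇒¬bridge G free (<σ⇒≢ a<b) (<σ⇒≢ b<c) (<σ⇒≢ (<-trans d<b b<c)) ac db ¬ab ¬dc
      with <-cmp (pos σ d) (pos σ a)
    ... | tri< d<a _ _ = go (earlier a<b) d b (d<a , a<b , db , ¬da)
    ... | tri≈ _ d≈a _ = ¬ab (subst (λ x → E G x b) (pos-inj σ d≈a) db)
    ... | tri> _ _ a<d = go (earlier d<b) a c (a<d , <-trans d<b b<c , ac , λ ad → ¬da (Graph.sym G ad))

lemma12 : ∀ {n : ℕ} (G : Graph n) → Connected G → P4C4Free G →
    (σ : Ordering n) → IsMNS G σ → IsLexDFS G σ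
lemma12 G _ free σ mns a b c a<b b<c ac ¬ab =
  ⊥-elim (MNS⇒no-obstruction G σ free mns a b c (a<b , b<c , ac , ¬ab))
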